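{- Let $0\le i<j<r$ be integers, let $q=2^r$, let $a\in\mathbb{F}_q^*$, let $t=2^i+2^j$, and let $G(x):=x^{2^i-1}+x^{2^j-1}$. Then the monomial $ax^{2^i+2^j}$ is planar on $\mathbb{F}_q$ if and only if the sets $G(\mathbb{F}_q^*)=\{G(c):c\in\mathbb{F}_q^*\}$ and $a^{ -1}(\mathbb{F}_q^*)^{t-2}=\{a^{ -1}b^{t-2}: b\in\mathbb{F}_q^*\}$ are disjoint.
   Context: For $q$ a power of $2$, a polynomial $F\in\mathbb{F}_q[x]$ (or the function $c\mapsto F(c)$ on $\mathbb{F}_q$) is called planar if, for every $d\in\mathbb{F}_q^*$, the function $c\mapsto F(c+d)+F(c)+dc$ is a bijection on $\mathbb{F}_q$. -}

module Defs where

open import Level using (0ℓ)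
open import Data.Nat using (ℕ; zero; suc)
open import Data.Fin using (Fin)
open import Data.Product using (Σ; _×_; ∃)
open import Relation.Binary.PropositionalEquality using (_≡_; _≢_)
open import Relation.Nullary using (¬_)
open import Algebra.Structures using (IsCommutativeRing)
open import Function.Bundles using (_↔_)
open import Function.Definitions using (Bijective)

record FiniteField (q : ℕ) : Set₁ where
  infixl 6 _+_
  infixl 7 _*_
  field
    Carrier : Set
    _+_ _*_ : Carrier → Carrier → Carrier
    -_ : Carrier → Carrier
    0# 1# : Carrier
    _⁻¹ : Carrier → Carrier
    isCommutativeRing : IsCommutativeRing _≡_ _+_ _*_ -_ 0# 1#
    0≢1 : 0# ≢ 1#
    inverseʳ : ∀ x → x ≢ 0# → x * (x ⁻¹) ≡ 1#
    enumeration : Carrier ↔ Fin q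

  infixr 8 _^ᶠ_
  _^ᶠ_ : Carrier → ℕ → Carrier
  x ^ᶠ zero = 1#
  x ^ᶠ suc n = x * (x ^ᶠ n)

  -- planarity (characteristic 2 convention): for every nonzero d,
  -- c ↦ F(c+d) + F(c) + d c is a bijection of the field
  Planar : (Carrier → Carrier) → Set
  Planar f = ∀ d → d ≢ 0# → Bijective _≡_ _≡_ (λ c → f (c + d) + f c + d * c)

  Disjoint : (Carrier → Set) → (Carrier → Set) → Set
  Disjoint A B = ∀ x → ¬ (A x × B x)

  ImageOnUnits : (Carrier → Carrier) → Carrier → Set
  ImageOnUnits f y = Σ Carrier (λ c → c ≢ 0# × f c ≡ y)

module Submission where

-- In characteristic 2 the powers x ↦ x ^ 2 ^ k are additive, so for
-- F c = a c ^ t with t = 2 ^ i + 2 ^ j the map c ↦ F (c + d) + F c + d c is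
-- an additive map Λ d plus the constant F d.  It is therefore bijective iff
-- Λ d has trivial kernel.  Writing a kernel element as c = d x one finds
-- Λ d (d x) = d² x (a dᵗ⁻² G x + 1), so a nonzero kernel element exists
-- exactly when G x = a⁻¹ (d⁻¹)ᵗ⁻² for some x ≠ 0, i.e. exactly when
-- G(F_q^*) meets a⁻¹ (F_q^*)ᵗ⁻².

open import Defs
open import Level using (0ℓ)
open import Algebra.Bundles using (CommutativeRing)
open import Data.Nat using (ℕ; zero; suc; s≤s; _<_; _≤_; _^_; _∸_)
  renaming (_+_ to _+ℕ_; _*_ to _*ℕ_)
import Data.Nat.Properties as ℕ
open import Data.Fin using (Fin; punchIn; punchOut)
open import Data.Fin.Properties
  using (_≟_; _<?_; <-cmp; <-irrefl; any?; inj⇒≟; injective⇒≤; punchOut-injective; punchInᵢ≢i)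
open import Data.Fin.Permutation using (permutation)
open import Data.Product using (∃; _,_; proj₁)
open import Function using (_∘_; _⟨_⟩_)
open import Function.Definitions using (Injective; Bijective)
open import Function.Bundles using (_↔_; _⇔_; mk⇔; Equivalence; Inverse; Injection)
open import Function.Properties.Inverse using (↔⇒↣; ↔-sym)
open import Relation.Binary.Definitions using (tri<; tri≈; tri>)
open import Relation.Binary.PropositionalEquality
open import Relation.Nullary using (¬_; Dec; yes; no; contradiction)
open import Algebra.Properties.CommutativeMonoid.Sum ℕ.+-0-commutativeMonoid
  using (sum; sum-cong-≗; sum-permute; sum-remove; ∑-distrib-+; sum-replicate-zero)

injective⇒surjective : ∀ {n} {f : Fin n → Fin n} → Injective _≡_ _≡_ f →
                       ∀ y → ∃ λ x → f x ≡ y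
injective⇒surjective {zero}  _ ()
injective⇒surjective {suc m} {f} f-inj y with any? (λ x → f x ≟ y)
... | yes hit = hit
... | no miss = contradiction (injective⇒≤ avoid-y-injective) ℕ.1+n≰n
  where
  avoid-y : Fin (suc m) → Fin m
  avoid-y x = punchOut {i = y} {j = f x} λ y≡fx → miss (x , sym y≡fx)

  avoid-y-injective : Injective _≡_ _≡_ avoid-y
  avoid-y-injective = f-inj ∘ punchOut-injective {i = y} _ _

injective⇒bijective : ∀ {a n} {A : Set a} → A ↔ Fin n →
                      {f : A → A} → Injective _≡_ _≡_ f → Bijective _≡_ _≡_ f
injective⇒bijective {n = n} A↔Fin {f} f-inj = f-inj , λ y →
  let k , gk≡y = injective⇒surjective g-inj (to y)
  in from k , λ { refl → to-injective gk≡y }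
  where
  open Inverse A↔Fin using (to; from)
  to-injective : Injective _≡_ _≡_ to
  to-injective = Injection.injective (↔⇒↣ A↔Fin)
  from-injective : Injective _≡_ _≡_ from
  from-injective = Injection.injective (↔⇒↣ (↔-sym A↔Fin))
  g : Fin n → Fin n
  g = to ∘ f ∘ from
  g-inj : Injective _≡_ _≡_ g
  g-inj = from-injective ∘ f-inj ∘ to-injective

𝟙 : ∀ {p} {P : Set p} → Dec P → ℕ
𝟙 (yes _) = 1
𝟙 (no _)  = 0

𝟙-yes : ∀ {p} {P : Set p} (P? : Dec P) → P → 𝟙 P? ≡ 1
𝟙-yes (yes _) _ = refl
𝟙-yes (no ¬p) p = contradiction p ¬p

𝟙-no : ∀ {p} {P : Set p} (P? : Dec P) → ¬ P → 𝟙 P? ≡ 0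
𝟙-no (yes p) ¬p = contradiction p ¬p
𝟙-no (no _)  _  = refl

sum-ones : ∀ n → sum {n} (λ _ → 1) ≡ n
sum-ones zero    = refl
sum-ones (suc n) = cong suc (sum-ones n)

sum-𝟙-singleton : ∀ {n} (e : Fin n) → sum (λ k → 𝟙 (k ≟ e)) ≡ 1
sum-𝟙-singleton {suc n} e = begin
  sum (λ k → 𝟙 (k ≟ e))                          ≡⟨ sum-remove {i = e} (λ k → 𝟙 (k ≟ e)) ⟩
  𝟙 (e ≟ e) +ℕ sum (λ k → 𝟙 (punchIn e k ≟ e))  ≡⟨ cong₂ _+ℕ_ (𝟙-yes (e ≟ e) refl)
                                                       (sum-cong-≗ λ k → 𝟙-no _ (punchInᵢ≢i e k)) ⟩
  1 +ℕ sum {n} (λ _ → 0)                         ≡⟨ cong suc (sum-replicate-zero n) ⟩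
  1                                              ∎
  where open ≡-Reasoning

module _ {n} (τ : Fin n → Fin n) (τ-involutive : ∀ k → τ (τ k) ≡ k) where

  private
    ascents descents : Fin n → ℕ
    ascents  k = 𝟙 (k <? τ k)
    descents k = 𝟙 (τ k <? k)

    ascents∘τ≗descents : ∀ k → ascents (τ k) ≡ descents k
    ascents∘τ≗descents k = cong (λ j → 𝟙 (τ k <? j)) (τ-involutive k)

    descents≡ascents : sum descents ≡ sum ascents
    descents≡ascents = begin
      sum descents        ≡⟨ sum-cong-≗ ascents∘τ≗descents ⟨
      sum (ascents ∘ τ)   ≡⟨ sum-permute ascents (permutation τ τ τ-involutive τ-involutive) ⟨
      sum ascents         ∎
      where open ≡-Reasoning

  involution-unique-fixed-point⇒odd : (e : Fin n) → (∀ k → τ k ≡ k → k ≡ e) → τ e ≡ e →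
                                      ∃ λ m → n ≡ suc (2 *ℕ m)
  involution-unique-fixed-point⇒odd e fixed⇒e τe≡e = sum ascents , (begin
    n                                                ≡⟨ sum-ones n ⟨
    sum {n} (λ _ → 1)                                ≡⟨ sum-cong-≗ trichotomy ⟨
    sum (λ k → ascents k +ℕ descents k +ℕ fixed k)   ≡⟨ ∑-distrib-+ _ fixed ⟩
    sum (λ k → ascents k +ℕ descents k) +ℕ sum fixed ≡⟨ cong (_+ℕ sum fixed) (∑-distrib-+ ascents descents) ⟩
    sum ascents +ℕ sum descents +ℕ sum fixed         ≡⟨ cong₂ (λ u v → sum ascents +ℕ u +ℕ v) descents≡ascents (sum-𝟙-singleton e) ⟩
    sum ascents +ℕ sum ascents +ℕ 1                  ≡⟨ ℕ.+-comm _ 1 ⟩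
    suc (sum ascents +ℕ sum ascents)                 ≡⟨ cong (λ u → suc (sum ascents +ℕ u)) (ℕ.+-identityʳ _) ⟨
    suc (2 *ℕ sum ascents)                           ∎)
    where
    open ≡-Reasoning

    fixed : Fin n → ℕ
    fixed k = 𝟙 (k ≟ e)

    trichotomy : ∀ k → ascents k +ℕ descents k +ℕ fixed k ≡ 1
    trichotomy k with <-cmp k (τ k)
    ... | tri< k<τk _ τk≮k =
      cong₂ (λ u v → u +ℕ v +ℕ fixed k) (𝟙-yes (k <? τ k) k<τk) (𝟙-no (τ k <? k) τk≮k)
        ⟨ trans ⟩ cong suc (𝟙-no (k ≟ e) λ { refl → <-irrefl (sym τe≡e) k<τk })
    ... | tri≈ k≮τk k≡τk τk≮k =
      cong₂ (λ u v → u +ℕ v +ℕ fixed k) (𝟙-no (k <? τ k) k≮τk) (𝟙-no (τ k <? k) τk≮k)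
        ⟨ trans ⟩ 𝟙-yes (k ≟ e) (fixed⇒e k (sym k≡τk))
    ... | tri> k≮τk _ τk<k =
      cong₂ (λ u v → u +ℕ v +ℕ fixed k) (𝟙-no (k <? τ k) k≮τk) (𝟙-yes (τ k <? k) τk<k)
        ⟨ trans ⟩ cong suc (𝟙-no (k ≟ e) λ { refl → <-irrefl τe≡e τk<k })

module FiniteFieldProperties {q : ℕ} (K : FiniteField q) where
  open FiniteField K

  commutativeRing : CommutativeRing 0ℓ 0ℓ
  commutativeRing = record { isCommutativeRing = isCommutativeRing }

  open CommutativeRing commutativeRing
    using ( commutativeSemiring; ring; distribˡ; +-identityˡ; +-identityʳ; -‿inverseʳ
          ; *-identityˡ; *-identityʳ; *-comm; *-assoc; zeroˡ; zeroʳ)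
  open import Algebra.Properties.Ring ring using (-‿involutive; -0#≈0#)
  open import Algebra.Solver.Ring.NaturalCoefficients.Default commutativeSemiring
  open import Algebra.Properties.CommutativeSemiring.Exp commutativeSemiring
    using (^-homo-*; ^-distrib-*; ^-assocʳ) renaming (_^_ to _^ᶜ_)
  open ≡-Reasoning

  _≟ᶠ_ : (x y : Carrier) → Dec (x ≡ y)
  _≟ᶠ_ = inj⇒≟ (↔⇒↣ enumeration)

  inverseˡ : ∀ x → x ≢ 0# → x ⁻¹ * x ≡ 1#
  inverseˡ x x≢0 = trans (*-comm _ _) (inverseʳ x x≢0)

  *-inverse-unique : ∀ {u v w} → u * v ≡ 1# → u * w ≡ 1# → w ≡ v
  *-inverse-unique {u} {v} {w} uv≡1 uw≡1 = begin
    w             ≡⟨ *-identityˡ w ⟨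
    1# * w        ≡⟨ cong (_* w) uv≡1 ⟨
    (u * v) * w   ≡⟨ solve 3 (λ u v w → (u :* v) :* w := v :* (u :* w)) refl u v w ⟩
    v * (u * w)   ≡⟨ cong (v *_) uw≡1 ⟩
    v * 1#        ≡⟨ *-identityʳ v ⟩
    v             ∎

  x*y≡0⇒y≡0 : ∀ {x y} → x ≢ 0# → x * y ≡ 0# → y ≡ 0#
  x*y≡0⇒y≡0 {x} {y} x≢0 xy≡0 = begin
    y               ≡⟨ *-identityˡ y ⟨
    1# * y          ≡⟨ cong (_* y) (inverseˡ x x≢0) ⟨
    x ⁻¹ * x * y    ≡⟨ *-assoc _ _ _ ⟩
    x ⁻¹ * (x * y)  ≡⟨ cong (x ⁻¹ *_) xy≡0 ⟩
    x ⁻¹ * 0#       ≡⟨ zeroʳ _ ⟩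
    0#              ∎

  x*y≢0 : ∀ {x y} → x ≢ 0# → y ≢ 0# → x * y ≢ 0#
  x*y≢0 x≢0 y≢0 = y≢0 ∘ x*y≡0⇒y≡0 x≢0

  x⁻¹≢0 : ∀ {x} → x ≢ 0# → x ⁻¹ ≢ 0#
  x⁻¹≢0 {x} x≢0 x⁻¹≡0 = 0≢1 (begin
    0#          ≡⟨ zeroʳ x ⟨
    x * 0#      ≡⟨ cong (x *_) x⁻¹≡0 ⟨
    x * x ⁻¹    ≡⟨ inverseʳ x x≢0 ⟩
    1#          ∎)

  ^ᶠ≡^ : ∀ x n → x ^ᶠ n ≡ x ^ᶜ n
  ^ᶠ≡^ x zero    = refl
  ^ᶠ≡^ x (suc n) = cong (x *_) (^ᶠ≡^ x n)

  ^ᶠ-homo-* : ∀ x m n → x ^ᶠ (m +ℕ n) ≡ x ^ᶠ m * x ^ᶠ n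
  ^ᶠ-homo-* x m n
    rewrite ^ᶠ≡^ x (m +ℕ n) | ^ᶠ≡^ x m | ^ᶠ≡^ x n = ^-homo-* x m n

  ^ᶠ-distrib-* : ∀ x y n → (x * y) ^ᶠ n ≡ x ^ᶠ n * y ^ᶠ n
  ^ᶠ-distrib-* x y n
    rewrite ^ᶠ≡^ (x * y) n | ^ᶠ≡^ x n | ^ᶠ≡^ y n = ^-distrib-* x y n

  ^ᶠ-assocʳ : ∀ x m n → (x ^ᶠ m) ^ᶠ n ≡ x ^ᶠ (m *ℕ n)
  ^ᶠ-assocʳ x m n
    rewrite ^ᶠ≡^ (x ^ᶠ m) n | ^ᶠ≡^ x m | ^ᶠ≡^ x (m *ℕ n) = ^-assocʳ x m n

  1^ᶠn≡1 : ∀ n → 1# ^ᶠ n ≡ 1#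
  1^ᶠn≡1 zero    = refl
  1^ᶠn≡1 (suc n) = trans (cong (1# *_) (1^ᶠn≡1 n)) (*-identityˡ 1#)

  x*x^[n∸1]≡x^n : ∀ x {n} → 0 < n → x * x ^ᶠ (n ∸ 1) ≡ x ^ᶠ n
  x*x^[n∸1]≡x^n x {suc n} _ = refl

  -- Unless 1 + 1 ≡ 0, negation is an involution whose only fixed point is 0,
  -- which forces q to be odd.
  characteristic-two : ∀ m → q ≡ 2 *ℕ m → 1# + 1# ≡ 0#
  characteristic-two m q≡2m with (1# + 1#) ≟ᶠ 0#
  ... | yes 2≡0 = 2≡0
  ... | no  2≢0 =
    let m′ , q≡1+2m′ = involution-unique-fixed-point⇒odd negate negate-involutive
                         (to 0#) negate-fixed⇒zero negate-zero
    in  contradiction (trans (sym q≡2m) q≡1+2m′) (ℕ.even≢odd m m′)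
    where
    open Inverse enumeration using (to; from; strictlyInverseˡ; strictlyInverseʳ)

    -x≡x⇒x≡0 : ∀ x → - x ≡ x → x ≡ 0#
    -x≡x⇒x≡0 x -x≡x = x*y≡0⇒y≡0 2≢0 (begin
      (1# + 1#) * x  ≡⟨ solve 1 (λ x → (con 1 :+ con 1) :* x := x :+ x) refl x ⟩
      x + x          ≡⟨ cong (x +_) -x≡x ⟨
      x + - x        ≡⟨ -‿inverseʳ x ⟩
      0#             ∎)

    negate : Fin q → Fin q
    negate k = to (- from k)

    negate-involutive : ∀ k → negate (negate k) ≡ k
    negate-involutive k = begin
      to (- from (to (- from k)))  ≡⟨ cong (λ x → to (- x)) (strictlyInverseʳ _) ⟩
      to (- - from k)              ≡⟨ cong to (-‿involutive _) ⟩
      to (from k)                  ≡⟨ strictlyInverseˡ k ⟩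
      k                            ∎

    negate-fixed⇒zero : ∀ k → negate k ≡ k → k ≡ to 0#
    negate-fixed⇒zero k negate-k≡k = begin
      k            ≡⟨ strictlyInverseˡ k ⟨
      to (from k)  ≡⟨ cong to (-x≡x⇒x≡0 (from k) (sym (strictlyInverseʳ _) ⟨ trans ⟩ cong from negate-k≡k)) ⟩
      to 0#        ∎

    negate-zero : negate (to 0#) ≡ to 0#
    negate-zero = cong (λ x → to (- x)) (strictlyInverseʳ 0#) ⟨ trans ⟩ cong to -0#≈0#


  module Characteristic2 (1+1≡0 : 1# + 1# ≡ 0#) where

    x+x≡0 : ∀ x → x + x ≡ 0#
    x+x≡0 x = begin
      x + x          ≡⟨ solve 1 (λ x → x :+ x := (con 1 :+ con 1) :* x) refl x ⟩
      (1# + 1#) * x  ≡⟨ cong (_* x) 1+1≡0 ⟩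
      0# * x         ≡⟨ zeroˡ x ⟩
      0#             ∎

    x+y≡0⇒x≡y : ∀ {x y} → x + y ≡ 0# → x ≡ y
    x+y≡0⇒x≡y {x} {y} x+y≡0 = begin
      x              ≡⟨ +-identityʳ x ⟨
      x + 0#         ≡⟨ cong (x +_) (x+x≡0 y) ⟨
      x + (y + y)    ≡⟨ solve 2 (λ x y → x :+ (y :+ y) := (x :+ y) :+ y) refl x y ⟩
      (x + y) + y    ≡⟨ cong (_+ y) x+y≡0 ⟩
      0# + y         ≡⟨ +-identityˡ y ⟩
      y              ∎

    square-additive : ∀ x y → (x + y) ^ᶠ 2 ≡ x ^ᶠ 2 + y ^ᶠ 2
    square-additive x y = begin
      (x + y) ^ᶠ 2
        ≡⟨ solve 2 (λ x y → (x :+ y) :* ((x :+ y) :* con 1)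
                          := (x :* (x :* con 1) :+ y :* (y :* con 1)) :+ (x :* y :+ x :* y)) refl x y ⟩
      (x ^ᶠ 2 + y ^ᶠ 2) + (x * y + x * y)  ≡⟨ cong (x ^ᶠ 2 + y ^ᶠ 2 +_) (x+x≡0 (x * y)) ⟩
      (x ^ᶠ 2 + y ^ᶠ 2) + 0#               ≡⟨ +-identityʳ _ ⟩
      x ^ᶠ 2 + y ^ᶠ 2                      ∎

    frobenius : ∀ k x y → (x + y) ^ᶠ (2 ^ k) ≡ x ^ᶠ (2 ^ k) + y ^ᶠ (2 ^ k)
    frobenius zero    x y = solve 2 (λ x y → (x :+ y) :* con 1 := x :* con 1 :+ y :* con 1) refl x y
    frobenius (suc k) x y = begin
      (x + y) ^ᶠ (2 *ℕ 2 ^ k)                        ≡⟨ ^ᶠ-assocʳ (x + y) 2 (2 ^ k) ⟨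
      ((x + y) ^ᶠ 2) ^ᶠ (2 ^ k)                      ≡⟨ cong (_^ᶠ (2 ^ k)) (square-additive x y) ⟩
      (x ^ᶠ 2 + y ^ᶠ 2) ^ᶠ (2 ^ k)                   ≡⟨ frobenius k (x ^ᶠ 2) (y ^ᶠ 2) ⟩
      (x ^ᶠ 2) ^ᶠ (2 ^ k) + (y ^ᶠ 2) ^ᶠ (2 ^ k)      ≡⟨ cong₂ _+_ (^ᶠ-assocʳ x 2 (2 ^ k)) (^ᶠ-assocʳ y 2 (2 ^ k)) ⟩
      x ^ᶠ (2 *ℕ 2 ^ k) + y ^ᶠ (2 *ℕ 2 ^ k)          ∎

    module Monomial (A B : ℕ) (0<A : 0 < A) (0<B : 0 < B)
                    (A-additive : ∀ x y → (x + y) ^ᶠ A ≡ x ^ᶠ A + y ^ᶠ A)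
                    (B-additive : ∀ x y → (x + y) ^ᶠ B ≡ x ^ᶠ B + y ^ᶠ B)
                    (a : Carrier) where

      t s : ℕ
      t = A +ℕ B
      s = t ∸ 2

      F G : Carrier → Carrier
      F c = a * c ^ᶠ t
      G x = x ^ᶠ (A ∸ 1) + x ^ᶠ (B ∸ 1)

      Δ Λ : Carrier → Carrier → Carrier
      Δ d c = F (c + d) + F c + d * c
      Λ d c = a * (c ^ᶠ A * d ^ᶠ B + d ^ᶠ A * c ^ᶠ B) + d * c

      x*G[x]≡x^A+x^B : ∀ x → x * G x ≡ x ^ᶠ A + x ^ᶠ B
      x*G[x]≡x^A+x^B x = trans (distribˡ x _ _) (cong₂ _+_ (x*x^[n∸1]≡x^n x 0<A) (x*x^[n∸1]≡x^n x 0<B))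

      x^t≡x*x*x^s : ∀ x → x ^ᶠ t ≡ x * (x * x ^ᶠ s)
      x^t≡x*x*x^s x = cong (x ^ᶠ_) (sym (ℕ.m+[n∸m]≡n (ℕ.+-mono-≤ 0<A 0<B)))

      Δ≡Λ+F : ∀ d c → Δ d c ≡ Λ d c + F d
      Δ≡Λ+F d c = begin
        a * (c + d) ^ᶠ t + a * c ^ᶠ t + d * c
          ≡⟨ cong₂ (λ u v → a * u + a * v + d * c)
               (trans (^ᶠ-homo-* (c + d) A B) (cong₂ _*_ (A-additive c d) (B-additive c d))) (^ᶠ-homo-* c A B) ⟩
        a * ((c ^ᶠ A + d ^ᶠ A) * (c ^ᶠ B + d ^ᶠ B)) + a * (c ^ᶠ A * c ^ᶠ B) + d * c
          ≡⟨ solve 7 (λ a d c cA cB dA dB →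
               a :* ((cA :+ dA) :* (cB :+ dB)) :+ a :* (cA :* cB) :+ d :* c
               := ((a :* (cA :* dB :+ dA :* cB) :+ d :* c) :+ a :* (dA :* dB)) :+ (a :* (cA :* cB) :+ a :* (cA :* cB)))
               refl a d c (c ^ᶠ A) (c ^ᶠ B) (d ^ᶠ A) (d ^ᶠ B) ⟩
        (Λ d c + a * (d ^ᶠ A * d ^ᶠ B)) + (a * (c ^ᶠ A * c ^ᶠ B) + a * (c ^ᶠ A * c ^ᶠ B))
          ≡⟨ cong₂ _+_ (cong (λ u → Λ d c + a * u) (sym (^ᶠ-homo-* d A B))) (x+x≡0 _) ⟩
        (Λ d c + F d) + 0#
          ≡⟨ +-identityʳ _ ⟩
        Λ d c + F d ∎

      Λ-additive : ∀ d c c′ → Λ d (c + c′) ≡ Λ d c + Λ d c′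
      Λ-additive d c c′ = begin
        a * ((c + c′) ^ᶠ A * d ^ᶠ B + d ^ᶠ A * (c + c′) ^ᶠ B) + d * (c + c′)
          ≡⟨ cong₂ (λ u v → a * (u * d ^ᶠ B + d ^ᶠ A * v) + d * (c + c′)) (A-additive c c′) (B-additive c c′) ⟩
        a * ((c ^ᶠ A + c′ ^ᶠ A) * d ^ᶠ B + d ^ᶠ A * (c ^ᶠ B + c′ ^ᶠ B)) + d * (c + c′)
          ≡⟨ solve 10 (λ a d c c′ cA c′A cB c′B dA dB →
               a :* ((cA :+ c′A) :* dB :+ dA :* (cB :+ c′B)) :+ d :* (c :+ c′)
               := (a :* (cA :* dB :+ dA :* cB) :+ d :* c) :+ (a :* (c′A :* dB :+ dA :* c′B) :+ d :* c′))
               refl a d c c′ (c ^ᶠ A) (c′ ^ᶠ A) (c ^ᶠ B) (c′ ^ᶠ B) (d ^ᶠ A) (d ^ᶠ B) ⟩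
        Λ d c + Λ d c′ ∎

      Δ-sum : ∀ d c c′ → Δ d c + Δ d c′ ≡ Λ d (c + c′)
      Δ-sum d c c′ = begin
        Δ d c + Δ d c′                  ≡⟨ cong₂ _+_ (Δ≡Λ+F d c) (Δ≡Λ+F d c′) ⟩
        (Λ d c + F d) + (Λ d c′ + F d)  ≡⟨ solve 3 (λ u v w → (u :+ w) :+ (v :+ w) := (u :+ v) :+ (w :+ w)) refl _ _ _ ⟩
        (Λ d c + Λ d c′) + (F d + F d)  ≡⟨ cong (Λ d c + Λ d c′ +_) (x+x≡0 (F d)) ⟩
        (Λ d c + Λ d c′) + 0#           ≡⟨ +-identityʳ _ ⟩
        Λ d c + Λ d c′                  ≡⟨ Λ-additive d c c′ ⟨
        Λ d (c + c′)                    ∎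

      Λ-scaled : ∀ d x → Λ d (d * x) ≡ (d * d * x) * (a * d ^ᶠ s * G x + 1#)
      Λ-scaled d x = begin
        a * ((d * x) ^ᶠ A * d ^ᶠ B + d ^ᶠ A * (d * x) ^ᶠ B) + d * (d * x)
          ≡⟨ cong₂ (λ u v → a * (u * d ^ᶠ B + d ^ᶠ A * v) + d * (d * x)) (^ᶠ-distrib-* d x A) (^ᶠ-distrib-* d x B) ⟩
        a * (d ^ᶠ A * x ^ᶠ A * d ^ᶠ B + d ^ᶠ A * (d ^ᶠ B * x ^ᶠ B)) + d * (d * x)
          ≡⟨ solve 7 (λ a d x dA dB xA xB →
               a :* (dA :* xA :* dB :+ dA :* (dB :* xB)) :+ d :* (d :* x)
               := a :* (dA :* dB) :* (xA :+ xB) :+ d :* (d :* x))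
               refl a d x (d ^ᶠ A) (d ^ᶠ B) (x ^ᶠ A) (x ^ᶠ B) ⟩
        a * (d ^ᶠ A * d ^ᶠ B) * (x ^ᶠ A + x ^ᶠ B) + d * (d * x)
          ≡⟨ cong₂ (λ u v → a * u * v + d * (d * x))
               (trans (sym (^ᶠ-homo-* d A B)) (x^t≡x*x*x^s d)) (sym (x*G[x]≡x^A+x^B x)) ⟩
        a * (d * (d * d ^ᶠ s)) * (x * G x) + d * (d * x)
          ≡⟨ solve 5 (λ a d x ds g →
               a :* (d :* (d :* ds)) :* (x :* g) :+ d :* (d :* x)
               := (d :* d :* x) :* (a :* ds :* g :+ con 1))
               refl a d x (d ^ᶠ s) (G x) ⟩
        (d * d * x) * (a * d ^ᶠ s * G x + 1#) ∎

      Λ-kernel : ∀ {d x} → d ≢ 0# → x ≢ 0# → Λ d (d * x) ≡ 0# ⇔ a * d ^ᶠ s * G x ≡ 1#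
      Λ-kernel {d} {x} d≢0 x≢0 = mk⇔
        (λ Λ≡0 → x+y≡0⇒x≡y (x*y≡0⇒y≡0 (x*y≢0 (x*y≢0 d≢0 d≢0) x≢0) (trans (sym (Λ-scaled d x)) Λ≡0)))
        (λ adˢGx≡1 → begin
          Λ d (d * x)                            ≡⟨ Λ-scaled d x ⟩
          (d * d * x) * (a * d ^ᶠ s * G x + 1#)  ≡⟨ cong (λ u → (d * d * x) * (u + 1#)) adˢGx≡1 ⟩
          (d * d * x) * (1# + 1#)                ≡⟨ cong ((d * d * x) *_) 1+1≡0 ⟩
          (d * d * x) * 0#                       ≡⟨ zeroʳ _ ⟩
          0#                                     ∎)

      adˢ*a⁻¹bˢ≡1 : ∀ {d b} → a ≢ 0# → d * b ≡ 1# → (a * d ^ᶠ s) * (a ⁻¹ * b ^ᶠ s) ≡ 1#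
      adˢ*a⁻¹bˢ≡1 {d} {b} a≢0 db≡1 = begin
        (a * d ^ᶠ s) * (a ⁻¹ * b ^ᶠ s)  ≡⟨ solve 4 (λ a a⁻¹ ds bs → (a :* ds) :* (a⁻¹ :* bs) := (a :* a⁻¹) :* (ds :* bs))
                                             refl a (a ⁻¹) (d ^ᶠ s) (b ^ᶠ s) ⟩
        (a * a ⁻¹) * (d ^ᶠ s * b ^ᶠ s)  ≡⟨ cong₂ _*_ (inverseʳ a a≢0) (sym (^ᶠ-distrib-* d b s)) ⟩
        1# * (d * b) ^ᶠ s               ≡⟨ cong (λ u → 1# * u ^ᶠ s) db≡1 ⟩
        1# * 1# ^ᶠ s                    ≡⟨ cong (1# *_) (1^ᶠn≡1 s) ⟩
        1# * 1#                         ≡⟨ *-identityˡ 1# ⟩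
        1#                              ∎

      adˢz≡1⇔z≡a⁻¹bˢ : ∀ {d b} → a ≢ 0# → d * b ≡ 1# → ∀ z → a * d ^ᶠ s * z ≡ 1# ⇔ z ≡ a ⁻¹ * b ^ᶠ s
      adˢz≡1⇔z≡a⁻¹bˢ a≢0 db≡1 z = mk⇔
        (*-inverse-unique (adˢ*a⁻¹bˢ≡1 a≢0 db≡1))
        (λ { refl → adˢ*a⁻¹bˢ≡1 a≢0 db≡1 })

      planar⇒disjoint : a ≢ 0# → Planar F →
                        Disjoint (ImageOnUnits G) (ImageOnUnits (λ b → a ⁻¹ * b ^ᶠ s))
      planar⇒disjoint a≢0 planar y ((x , x≢0 , Gx≡y) , (b , b≢0 , a⁻¹bˢ≡y)) =
        x*y≢0 d≢0 x≢0 (proj₁ (planar d d≢0) (x+y≡0⇒x≡y Δdx+Δ0≡0))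
        where
        d : Carrier
        d = b ⁻¹

        d≢0 : d ≢ 0#
        d≢0 = x⁻¹≢0 b≢0

        adˢGx≡1 : a * d ^ᶠ s * G x ≡ 1#
        adˢGx≡1 = Equivalence.from (adˢz≡1⇔z≡a⁻¹bˢ a≢0 (inverseˡ b b≢0) (G x)) (trans Gx≡y (sym a⁻¹bˢ≡y))

        Δdx+Δ0≡0 : Δ d (d * x) + Δ d 0# ≡ 0#
        Δdx+Δ0≡0 = begin
          Δ d (d * x) + Δ d 0#  ≡⟨ Δ-sum d (d * x) 0# ⟩
          Λ d (d * x + 0#)      ≡⟨ cong (Λ d) (+-identityʳ _) ⟩
          Λ d (d * x)           ≡⟨ Equivalence.from (Λ-kernel d≢0 x≢0) adˢGx≡1 ⟩
          0#                    ∎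

      disjoint⇒planar : a ≢ 0# → Disjoint (ImageOnUnits G) (ImageOnUnits (λ b → a ⁻¹ * b ^ᶠ s)) →
                        Planar F
      disjoint⇒planar a≢0 disjoint d d≢0 = injective⇒bijective enumeration Δ-injective
        where
        Δ-injective : Injective _≡_ _≡_ (Δ d)
        Δ-injective {c} {c′} Δc≡Δc′ with (c + c′) ≟ᶠ 0#
        ... | yes c+c′≡0 = x+y≡0⇒x≡y c+c′≡0
        ... | no  c+c′≢0 = contradiction ((x , x≢0 , refl) , (d ⁻¹ , x⁻¹≢0 d≢0 , sym Gx≡a⁻¹[d⁻¹]ˢ)) (disjoint (G x))
          where
          x : Carrier
          x = d ⁻¹ * (c + c′)

          x≢0 : x ≢ 0#
          x≢0 = x*y≢0 (x⁻¹≢0 d≢0) c+c′≢0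

          dx≡c+c′ : d * x ≡ c + c′
          dx≡c+c′ = begin
            d * (d ⁻¹ * (c + c′))  ≡⟨ *-assoc _ _ _ ⟨
            d * d ⁻¹ * (c + c′)    ≡⟨ cong (_* (c + c′)) (inverseʳ d d≢0) ⟩
            1# * (c + c′)          ≡⟨ *-identityˡ _ ⟩
            c + c′                 ∎

          Λdx≡0 : Λ d (d * x) ≡ 0#
          Λdx≡0 = begin
            Λ d (d * x)        ≡⟨ cong (Λ d) dx≡c+c′ ⟩
            Λ d (c + c′)       ≡⟨ Δ-sum d c c′ ⟨
            Δ d c + Δ d c′     ≡⟨ cong (_+ Δ d c′) Δc≡Δc′ ⟩
            Δ d c′ + Δ d c′    ≡⟨ x+x≡0 _ ⟩
            0#                 ∎

          Gx≡a⁻¹[d⁻¹]ˢ : G x ≡ a ⁻¹ * (d ⁻¹) ^ᶠ s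
          Gx≡a⁻¹[d⁻¹]ˢ = Equivalence.to (adˢz≡1⇔z≡a⁻¹bˢ a≢0 (inverseʳ d d≢0) (G x))
                           (Equivalence.to (Λ-kernel d≢0 x≢0) Λdx≡0)

-- Only r ≥ 1 (which makes the characteristic 2) is used; the argument
-- needs no order relation between i and j.
lemma3p1 : (i j r : ℕ) → 0 ≤ i → i < j → j < r →
    (K : FiniteField (2 ^ r)) →
    let open FiniteField K
        t = (2 ^ i) +ℕ (2 ^ j)
        G = λ (x : Carrier) → (x ^ᶠ ((2 ^ i) ∸ 1)) + (x ^ᶠ ((2 ^ j) ∸ 1))
    in (a : Carrier) → a ≢ 0# →
       Planar (λ c → a * (c ^ᶠ t)) ⇔
       Disjoint (ImageOnUnits G) (ImageOnUnits (λ b → (a ⁻¹) * (b ^ᶠ (t ∸ 2))))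
lemma3p1 i j (suc r) _ _ (s≤s _) K a a≢0 = mk⇔ (planar⇒disjoint a≢0) (disjoint⇒planar a≢0)
  where
  open FiniteFieldProperties K
  open Characteristic2 (characteristic-two (2 ^ r) refl)
  open Monomial (2 ^ i) (2 ^ j) (ℕ.m^n>0 2 i) (ℕ.m^n>0 2 j) (frobenius i) (frobenius j) a
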